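{- Let $T$ be a finite tree with maximum degree $\Delta(T)\leq 4$, and let $v$ be a vertex of $T$ of degree $k\geq 1$ with neighbors $w_1,\ldots,w_k$. For $i=1,\ldots,k$ let $T_i$ be the shrub of $T$ rooted at $v$ with root edge $vw_i$, and let $\phi^i$ be a $2$-aliec of $T_i$ in colors $a,b$ with $\phi^i(vw_i)=a$. Suppose that $\phi^i$ is a $2$-liec of $T_i$ for every $i=1,\ldots,k$. Let $\phi=\sum_{i=1}^k\phi^i$ be the corresponding shrub based coloring of $T$. If $\phi$ is inversion resistant, then one of the following holds: (1) $d_T(v)=3$ and the $a$-sequence of $v$ under $\phi$ is $3,2,2$; (2) $d_T(v)=4$ and the $a$-sequence of $v$ under $\phi$ is $4,3,3,2$.
   Context: All graphs are simple and finite. A graph is locally irregular if the two end-vertices of every edge have distinct degrees. A $k$-liec (locally irregular $k$-edge coloring) of a graph is an edge coloring with colors from a set of $k$ colors such that each color class induces a locally irregular subgraph; a $2$-liec uses two colors $a,b$. A shrub is a tree rooted at a leaf; the unique edge incident to the root is the root edge. A $2$-aliec (almost locally irregular $2$-edge coloring) of a shrub, in colors $a,b$, is an edge coloring with colors $a,b$ in which the root edge has color $a$ and which is either a $2$-liec, or is such that the root edge is not adjacent to any other edge of its color and every other edge satisfies local irregularity in its color class (i.e. the only violation of local irregularity is at the root edge). For a vertex $v$ of a tree $T$ with neighbors $w_1,\dots,w_k$, the shrub $T_i$ rooted at $v$ consists of the edge $vw_i$ together with the component of $T-v$ containing $w_i$, rooted at $v$. Given colorings $\phi^i$ of the edge-disjoint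 shrubs $T_i$ whose union is $T$, $\sum_i\phi^i$ is the coloring of $T$ agreeing with $\phi^i$ on $E(T_i)$; it is called a shrub based coloring. The inversion of a coloring of $T_i$ swaps colors $a$ and $b$. A shrub based coloring $\sum_i\phi^i$ is inversion resistant if neither it nor any coloring obtained from it by inverting the colors in some subset of the shrubs $T_i$ is a $2$-liec of $T$. The $a$-degree of a vertex $w$ is the number of edges of color $a$ incident to $w$. If all edges $vw_1,\dots,vw_k$ have color $a$, the $a$-sequence of $v$ is the sequence of $a$-degrees of $w_1,\dots,w_k$, listed in non-increasing order. -}

module Defs where

open import Data.Nat using (ℕ; zero; suc; _+_; _≤_)
open import Data.Nat.Properties using (≤-decTotalOrder)
open import Data.Bool using (Bool; true; false; if_then_else_)
open import Data.List using (List; []; _∷_; length; map)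
open import Data.Product using (_×_; _,_)
open import Data.Unit using (⊤)
open import Relation.Nullary using (¬_)
open import Relation.Binary.PropositionalEquality using (_≡_; _≢_)
import Relation.Binary.Properties.DecTotalOrder as DTO
import Data.List.Sort as Sort

data Color : Set where
  a b : Color

swap : Color → Color
swap a = b
swap b = a

[_≡ᶜ_] : Color → Color → ℕ
[ a ≡ᶜ a ] = 1
[ b ≡ᶜ b ] = 1
[ a ≡ᶜ b ] = 0
[ b ≡ᶜ a ] = 0

-- An edge-coloured finite tree, rooted at a vertex: a vertex together with
-- the list of its child edges, each edge carrying its colour and the
-- subtree hanging below it.
data CTree : Set where
  node : List (Color × CTree) → CTree

Edges : Set
Edges = List (Color × CTree)

cnt : Color → Edges → ℕ
cnt c [] = 0
cnt c ((d , _) ∷ es) = [ c ≡ᶜ d ] + cnt c es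

-- Local irregularity of every edge below a vertex.
-- 'deg c' is the c-degree (number of incident edges of colour c, including
-- the edge to its parent, if any) of the current vertex, and 'es' its child edges.
-- For a child edge of colour c to a child w with child edges ds, the
-- c-degree of w is cnt c ds + 1; we require it to differ from the c-degree
-- of the current vertex (endpoints of the edge have distinct degrees in the
-- subgraph induced by colour class c), and recurse.
Irreg : (Color → ℕ) → Edges → Set
Irreg deg [] = ⊤
Irreg deg ((c , node ds) ∷ es) =
  (deg c ≢ cnt c ds + 1)
  × Irreg (λ d → cnt d ds + [ d ≡ᶜ c ]) ds
  × Irreg deg es

IsLiec : Edges → Set
IsLiec es = Irreg (λ d → cnt d es) es

-- A coloured shrub: the root edge (with its colour) and the subtree below it.
-- The root of the shrub is a leaf, so its d-degree is [d = colour of root edge].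
Shrub : Set
Shrub = Color × CTree

IsLiecShrub : Shrub → Set
IsLiecShrub (c , t) = Irreg (λ d → [ d ≡ᶜ c ]) ((c , t) ∷ [])

-- Maximum degree ≤ 4 (for vertices strictly below v: at most 3 children,
-- since they also have a parent edge).
BoundedBelow : Edges → Set
BoundedBelow [] = ⊤
BoundedBelow ((c , node ds) ∷ es) = length ds ≤ 3 × BoundedBelow ds × BoundedBelow es

MaxDeg≤4 : Edges → Set
MaxDeg≤4 es = length es ≤ 4 × BoundedBelow es

mutual
  invT : CTree → CTree
  invT (node es) = node (invE es)

  invE : Edges → Edges
  invE [] = []
  invE ((c , t) ∷ es) = (swap c , invT t) ∷ invE es

invShrub : Shrub → Shrub
invShrub (c , t) = (swap c , invT t)

invertSome : List Bool → List Shrub → Edges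
invertSome [] ss = ss
invertSome (f ∷ fs) [] = []
invertSome (f ∷ fs) (s ∷ ss) = (if f then invShrub s else s) ∷ invertSome fs ss

-- Inversion resistant: no choice of subset (given by a flag per shrub)
-- yields a 2-liec of T (the empty subset gives φ itself).
InversionResistant : List Shrub → Set
InversionResistant ss =
  (fs : List Bool) → length fs ≡ length ss → ¬ IsLiec (invertSome fs ss)

-- a-degree of the child w at the end of a root edge of colour a
aDegChild : CTree → ℕ
aDegChild (node ds) = cnt a ds + 1

open Sort (DTO.≥-decTotalOrder ≤-decTotalOrder) using (sort) public

-- a-sequence of v when all root edges have colour a: the subtrees below w_i
aSequence : List CTree → List ℕ
aSequence ts = sort (map aDegChild ts)

-- 2-aliec of a shrub with root edge of colour c (the paper requires c = a):
-- either a 2-liec, or the root edge is adjacent to no other edge of its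
-- colour and every other edge is locally irregular in its colour class.
open import Data.Sum using (_⊎_)

IsAliecShrub : Shrub → Set
IsAliecShrub (c , node ds) =
  IsLiecShrub (c , node ds)
  ⊎ (cnt c ds ≡ 0 × Irreg (λ d → cnt d ds + [ d ≡ᶜ c ]) ds)

-- Inverting a shrub preserves local irregularity inside it, and under φ every edge below v is
-- already locally irregular; so inverting a set of shrubs can only break irregularity at the
-- edges vwᵢ. The a-degree dᵢ of wᵢ in φ lies in {2, 3, 4}: it is not 1 because φⁱ is a 2-liec
-- whose root is a leaf, and at most 4 since Δ(T) ≤ 4. After inverting φⁱ the edge vwᵢ has
-- colour b and wᵢ has b-degree dᵢ. Hence φ fails to be inversion resistant as soon as the
-- indices can be 2-coloured so that every dᵢ differs from the size of its colour class, and an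
-- exhaustive search over the at most 3⁴ sequences shows that this is impossible only for the
-- sequences 3,2,2 and 4,3,3,2.
module Submission where

open import Defs
open import Data.Nat using (ℕ; zero; suc; _+_; _≤_; _≟_; z≤n; s≤s)
open import Data.Nat.Properties using (≤-decTotalOrder; ≤-trans; +-mono-≤; suc-injective)
open import Data.Bool using (Bool; true; false; if_then_else_)
open import Data.List using (List; []; _∷_; length; map; cartesianProductWith)
open import Data.List.Properties using (length-map; ≡-dec)
open import Data.List.Membership.Propositional using (_∈_)
open import Data.List.Membership.Propositional.Properties using (∈-cartesianProductWith⁺)
open import Data.List.Relation.Unary.All as All using (All; []; _∷_; all?)
open import Data.List.Relation.Unary.Any using (Any; here; there; any?; satisfied)
open import Data.List.Relation.Binary.Pointwise
  using (Pointwise; []; _∷_; Pointwise-length; Pointwise-≡⇒≡; decidable)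
import Data.List.Relation.Binary.Permutation.Setoid as Perm
open import Data.List.Relation.Unary.Sorted.TotalOrder.Properties using (↗↭↗⇒≋)
open import Data.List.Sort.Base using (SortingAlgorithm)
import Data.List.Sort as Sort
import Data.List.Sort.InsertionSort as InsertionSort
open import Data.Product using (_×_; _,_; ∃)
import Data.Product as Product
open import Data.Sum using (_⊎_)
import Data.Sum as Sum
open import Data.Unit using (tt)
open import Function using (_∘_)
open import Relation.Binary.Bundles using (TotalOrder; DecTotalOrder)
import Relation.Binary.Properties.DecTotalOrder as DecTotalOrderProperties
open import Relation.Binary.PropositionalEquality
  using (_≡_; _≢_; refl; sym; trans; cong₂)
open import Relation.Nullary using (Dec; ¬?; _×-dec_; _⊎-dec_; contradiction)
open import Relation.Nullary.Decidable using (From-yes; from-yes; map′)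

≡ᶜ-swapʳ : ∀ c d → [ c ≡ᶜ swap d ] ≡ [ swap c ≡ᶜ d ]
≡ᶜ-swapʳ a a = refl
≡ᶜ-swapʳ a b = refl
≡ᶜ-swapʳ b a = refl
≡ᶜ-swapʳ b b = refl

swap-involutive : ∀ c → swap (swap c) ≡ c
swap-involutive a = refl
swap-involutive b = refl

cnt-invE : ∀ c ds → cnt c (invE ds) ≡ cnt (swap c) ds
cnt-invE c [] = refl
cnt-invE c ((d , _) ∷ ds) = cong₂ _+_ (≡ᶜ-swapʳ c d) (cnt-invE c ds)

cnt≤length : ∀ c ds → cnt c ds ≤ length ds
cnt≤length c [] = z≤n
cnt≤length c ((d , _) ∷ ds) = +-mono-≤ (≡ᶜ≤1 c d) (cnt≤length c ds)
  where
  ≡ᶜ≤1 : ∀ c d → [ c ≡ᶜ d ] ≤ 1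
  ≡ᶜ≤1 a a = s≤s z≤n
  ≡ᶜ≤1 a b = z≤n
  ≡ᶜ≤1 b a = z≤n
  ≡ᶜ≤1 b b = s≤s z≤n

Irreg-cong : ∀ {f g} → (∀ d → f d ≡ g d) → ∀ es → Irreg f es → Irreg g es
Irreg-cong f≗g [] tt = tt
Irreg-cong f≗g ((c , node ds) ∷ es) (root , below , rest) =
  root ∘ trans (f≗g c) , below , Irreg-cong f≗g es rest

Irreg-invE : ∀ deg es → Irreg deg es → Irreg (deg ∘ swap) (invE es)
Irreg-invE deg [] tt = tt
Irreg-invE deg ((c , node ds) ∷ es) (root , below , rest) =
  root′ , Irreg-cong childDeg (invE ds) (Irreg-invE _ ds below) , Irreg-invE deg es rest
  where
  root′ : deg (swap (swap c)) ≢ cnt (swap c) (invE ds) + 1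
  root′ rewrite cnt-invE (swap c) ds | swap-involutive c = root
  childDeg : ∀ d → cnt (swap d) ds + [ swap d ≡ᶜ c ] ≡ cnt d (invE ds) + [ d ≡ᶜ swap c ]
  childDeg d = sym (cong₂ _+_ (cnt-invE d ds) (≡ᶜ-swapʳ d c))

IsLiecShrub-invShrub : ∀ s → IsLiecShrub s → IsLiecShrub (invShrub s)
IsLiecShrub-invShrub (c , t) liec =
  Irreg-cong (λ d → sym (≡ᶜ-swapʳ d c)) _ (Irreg-invE _ ((c , t) ∷ []) liec)

Irreg-∷-shrub : ∀ {deg c ds es} → IsLiecShrub (c , node ds) →
  deg c ≢ cnt c ds + 1 → Irreg deg es → Irreg deg ((c , node ds) ∷ es)
Irreg-∷-shrub (_ , below , _) root rest = root , below , rest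

flagColour : Bool → Color
flagColour f = if f then b else a

rootDegree : List Bool → Color → ℕ
rootDegree [] c = 0
rootDegree (f ∷ fs) c = [ c ≡ᶜ flagColour f ] + rootDegree fs c

RootIrregular : List Bool → List ℕ → Set
RootIrregular fs = Pointwise (λ f x → rootDegree fs (flagColour f) ≢ x) fs

aShrubs : List CTree → List Shrub
aShrubs = map (λ t → (a , t))

cnt-invertSome : ∀ c fs ts → length fs ≡ length ts →
  cnt c (invertSome fs (aShrubs ts)) ≡ rootDegree fs c
cnt-invertSome c [] [] _ = refl
cnt-invertSome c (false ∷ fs) (_ ∷ ts) e = cong₂ _+_ refl (cnt-invertSome c fs ts (suc-injective e))
cnt-invertSome c (true ∷ fs) (_ ∷ ts) e = cong₂ _+_ refl (cnt-invertSome c fs ts (suc-injective e))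

Irreg-invertSome : ∀ deg fs ts → All (λ t → IsLiecShrub (a , t)) ts →
  Pointwise (λ f x → deg (flagColour f) ≢ x) fs (map aDegChild ts) →
  Irreg deg (invertSome fs (aShrubs ts))
Irreg-invertSome deg [] [] [] [] = tt
Irreg-invertSome deg (false ∷ fs) (node ds ∷ ts) (liec ∷ liecs) (root ∷ roots) =
  Irreg-∷-shrub liec root (Irreg-invertSome deg fs ts liecs roots)
Irreg-invertSome deg (true ∷ fs) (node ds ∷ ts) (liec ∷ liecs) (root ∷ roots) =
  Irreg-∷-shrub (IsLiecShrub-invShrub (a , node ds) liec) root′ (Irreg-invertSome deg fs ts liecs roots)
  where
  root′ : deg b ≢ cnt b (invE ds) + 1
  root′ rewrite cnt-invE b ds = root

IsLiec-invertSome : ∀ fs ts → All (λ t → IsLiecShrub (a , t)) ts →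
  RootIrregular fs (map aDegChild ts) → IsLiec (invertSome fs (aShrubs ts))
IsLiec-invertSome fs ts liecs roots =
  Irreg-cong (λ c → sym (cnt-invertSome c fs ts lengths)) _ (Irreg-invertSome _ fs ts liecs roots)
  where
  lengths : length fs ≡ length ts
  lengths = trans (Pointwise-length roots) (length-map aDegChild ts)

childDegrees : List ℕ
childDegrees = 2 ∷ 3 ∷ 4 ∷ []

aDegChild-∈ : ∀ ds → length ds ≤ 3 → IsLiecShrub (a , node ds) → aDegChild (node ds) ∈ childDegrees
aDegChild-∈ ds len (root , _) = suc-∈ (cnt a ds) (≤-trans (cnt≤length a ds) len) root
  where
  suc-∈ : ∀ n → n ≤ 3 → 1 ≢ n + 1 → n + 1 ∈ childDegrees
  suc-∈ 0 _ 1≢1 with () ← 1≢1 refl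
  suc-∈ 1 _ _ = here refl
  suc-∈ 2 _ _ = there (here refl)
  suc-∈ 3 _ _ = there (there (here refl))
  suc-∈ (suc (suc (suc (suc _)))) (s≤s (s≤s (s≤s ()))) _

aDegChildren-∈ : ∀ ts → BoundedBelow (aShrubs ts) → All (λ t → IsLiecShrub (a , t)) ts →
  All (_∈ childDegrees) (map aDegChild ts)
aDegChildren-∈ [] _ [] = []
aDegChildren-∈ (node ds ∷ ts) (len , _ , below) (liec ∷ liecs) =
  aDegChild-∈ ds len liec ∷ aDegChildren-∈ ts below liecs

module _ {a ℓ₁ ℓ₂} (O : TotalOrder a ℓ₁ ℓ₂) where
  open TotalOrder O

  sortingAlgorithm-unique : (S₁ S₂ : SortingAlgorithm O) → ∀ xs →
    Pointwise _≈_ (SortingAlgorithm.sort S₁ xs) (SortingAlgorithm.sort S₂ xs)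
  sortingAlgorithm-unique S₁ S₂ xs = ↗↭↗⇒≋ O (S₁.sort-↗ xs) (S₂.sort-↗ xs)
    (Perm.↭-trans Eq.setoid (S₁.sort-↭ₛ xs) (Perm.↭-sym Eq.setoid (S₂.sort-↭ₛ xs)))
    where
    module S₁ = SortingAlgorithm S₁
    module S₂ = SortingAlgorithm S₂

≥-ℕ : DecTotalOrder _ _ _
≥-ℕ = DecTotalOrderProperties.≥-decTotalOrder ≤-decTotalOrder

-- The library's sort is abstract and does not compute; insertion sort does.
insertionSort : List ℕ → List ℕ
insertionSort = InsertionSort.sort ≥-ℕ

sort≡insertionSort : ∀ xs → sort xs ≡ insertionSort xs
sort≡insertionSort xs = Pointwise-≡⇒≡ (sortingAlgorithm-unique _
  (Sort.sortingAlgorithm ≥-ℕ) (InsertionSort.insertionSort ≥-ℕ) xs)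

Exceptional : List ℕ → Set
Exceptional xs = (length xs ≡ 3 × sort xs ≡ 3 ∷ 2 ∷ 2 ∷ [])
               ⊎ (length xs ≡ 4 × sort xs ≡ 4 ∷ 3 ∷ 3 ∷ 2 ∷ [])

exceptional? : ∀ xs → Dec (Exceptional xs)
exceptional? xs = map′ (Sum.map (Product.map₂ viaInsertion) (Product.map₂ viaInsertion))
                       (Sum.map (Product.map₂ toInsertion) (Product.map₂ toInsertion))
  ((length xs ≟ 3 ×-dec ≡-dec _≟_ (insertionSort xs) _) ⊎-dec
   (length xs ≟ 4 ×-dec ≡-dec _≟_ (insertionSort xs) _))
  where
  viaInsertion : ∀ {ys} → insertionSort xs ≡ ys → sort xs ≡ ys
  viaInsertion = trans (sort≡insertionSort xs)
  toInsertion : ∀ {ys} → sort xs ≡ ys → insertionSort xs ≡ ys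
  toInsertion = trans (sym (sort≡insertionSort xs))

tuples : {A : Set} → List A → ℕ → List (List A)
tuples cs zero = [] ∷ []
tuples cs (suc n) = cartesianProductWith _∷_ cs (tuples cs n)

∈-tuples : ∀ {A : Set} {cs : List A} {xs} → All (_∈ cs) xs → xs ∈ tuples cs (length xs)
∈-tuples [] = here refl
∈-tuples (c∈cs ∷ xs⊆cs) = ∈-cartesianProductWith⁺ _∷_ c∈cs (∈-tuples xs⊆cs)

RootIrregularizable : List ℕ → Set
RootIrregularizable xs = Any (λ fs → RootIrregular fs xs) (tuples (false ∷ true ∷ []) (length xs))

rootIrregularizable-or-exceptional? : ∀ xs → Dec (RootIrregularizable xs ⊎ Exceptional xs)
rootIrregularizable-or-exceptional? xs =
  any? (λ fs → decidable (λ f x → ¬? (rootDegree fs (flagColour f) ≟ x)) fs xs) _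
  ⊎-dec exceptional? xs

rootIrregular-or-exceptional : ∀ xs → length xs ≤ 4 → All (_∈ childDegrees) xs →
  (∃ λ fs → RootIrregular fs xs) ⊎ Exceptional xs
rootIrregular-or-exceptional xs len xs⊆ =
  Sum.map₁ satisfied (All.lookup (census (length xs) len) (∈-tuples xs⊆))
  where
  decided : ∀ n → From-yes (all? rootIrregularizable-or-exceptional? (tuples childDegrees n))
  decided n = from-yes (all? rootIrregularizable-or-exceptional? (tuples childDegrees n))

  census : ∀ n → n ≤ 4 → All (λ xs → RootIrregularizable xs ⊎ Exceptional xs) (tuples childDegrees n)
  census 0 _ = decided 0
  census 1 _ = decided 1
  census 2 _ = decided 2
  census 3 _ = decided 3
  census 4 _ = decided 4
  census (suc (suc (suc (suc (suc _))))) (s≤s (s≤s (s≤s (s≤s ()))))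

mainTheorem1 : (ts : List CTree) →
    1 ≤ length ts →
    MaxDeg≤4 (map (λ t → (a , t)) ts) →
    All (λ t → IsAliecShrub (a , t)) ts →
    All (λ t → IsLiecShrub (a , t)) ts →
    InversionResistant (map (λ t → (a , t)) ts) →
    (length ts ≡ 3 × aSequence ts ≡ 3 ∷ 2 ∷ 2 ∷ [])
    ⊎ (length ts ≡ 4 × aSequence ts ≡ 4 ∷ 3 ∷ 3 ∷ 2 ∷ [])
mainTheorem1 ts _ (degree≤4 , below) _ liecs resistant =
  Sum.[ noRootIrregularFlags , fromExceptional ]
    (rootIrregular-or-exceptional (map aDegChild ts) degrees≤4 (aDegChildren-∈ ts below liecs))
  where
  length-degrees : length (map aDegChild ts) ≡ length (aShrubs ts)
  length-degrees = trans (length-map aDegChild ts) (sym (length-map _ ts))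

  degrees≤4 : length (map aDegChild ts) ≤ 4
  degrees≤4 rewrite length-degrees = degree≤4

  noRootIrregularFlags : ∀ {C : Set} → (∃ λ fs → RootIrregular fs (map aDegChild ts)) → C
  noRootIrregularFlags (fs , roots) = contradiction (IsLiec-invertSome fs ts liecs roots)
    (resistant fs (trans (Pointwise-length roots) length-degrees))

  fromExceptional : Exceptional (map aDegChild ts) →
    (length ts ≡ 3 × aSequence ts ≡ 3 ∷ 2 ∷ 2 ∷ [])
    ⊎ (length ts ≡ 4 × aSequence ts ≡ 4 ∷ 3 ∷ 3 ∷ 2 ∷ [])
  fromExceptional = Sum.map (Product.map₁ (trans (sym (length-map aDegChild ts))))
                              (Product.map₁ (trans (sym (length-map aDegChild ts))))
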